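{- Let $T^*\in\mathbb{N}^*$, $N\ge 1$, integers $0=T_0<T_1<\dots<T_N<T^*$ and positive integers $n_1,\dots,n_N$ be given, and let the cost $C(t,\sigma)$ be as described in the context. Fix an inspection time $t\in\{1,\dots,T^*\}$ and let $N_t=\#\{i\in\{1,\dots,N\}:T_i\le t\}$. Let $\mathcal{A}_t$ be the set of block schedules in which, for each $k\le N_t$, all $n_k$ defects with deadline $T_k$ are repaired together at a common time $\rho_k\in\{T_0,T_1,\dots,T_k\}$, and for each $k>N_t$ all defects with deadline $T_k$ are repaired at $T_k$. Let $\mathcal{B}_t\subseteq\mathcal{A}_t$ be the set of those schedules with $\rho_1\in\{T_0,T_1\}$ and $\rho_k\in\{T_k,\rho_{k-1}\}$ for $2\le k\le N_t$ (so $\mathcal{B}_t$ has $2^{N_t}$ elements). Then $\min_{\sigma\in\mathcal{A}_t}C(t,\sigma)=\min_{\sigma\in\mathcal{B}_t}C(t,\sigma)$; i.e., for a given inspection time only these $2^{N_t}$ schedules need to be considered: each group $n_k$ is repaired either at its deadline $T_k$ or at the time at which the previous group $n_{k-1}$ is repaired.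
   Context: Pipeline preventive maintenance model. A time horizon $T^*\in\mathbb{N}^*$ is fixed; after a primary inspection at time $0$ the next inspection takes place at some time $t\in\{1,\dots,T^*\}$, with inspection interval $\Delta t=(0,t]$. There are $N\ge1$ distinct deadlines $T_1<\dots<T_N<T^*$ (positive integers), and for each $i$ there are $n_i\ge 1$ defects that must be repaired no later than $T_i$; set $T_0=0$. Costs: with inflation rate $r_i$ and discount rate $r_d$, $0\le r_i<r_d$, put $q=(1+r_i)/(1+r_d)\in(0,1)$, and $C_{insp}(s)=C^0_{insp}q^s$, $C_{rep}(s)=C^0_{rep}q^s$, $C_{out}(s)=C^0_{out}q^s$ with positive constants $C^0_{insp},C^0_{rep},C^0_{out}$ (inspection cost, per-defect repair cost, and out-of-service cost incurred at a time when repairs are carried out). A repair schedule $\sigma$ assigns to each defect, with deadline $T_i$, an integer repair time $\sigma(d)\in\{0,1,\dots,T_i\}$. For an inspection time $t$, the total cost is $C(t,\sigma)=C_{insp}(t)+\sum_{d:\,\sigma(d)\le t}C_{rep}(\sigma(d))+\sum_{r\in R_t(\sigma)}C_{out}(r)$, where $R_t(\sigma)=\{\sigma(d): d \text{ a defect}\}\cap(0,t]$ is the set of distinct positive repair times within $\Delta t$ (repairs at time $0$, during the primary inspection, incur no out-of-service cost, and repairs after $t$ are not counted).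
   Formalization: The factor q and the cost constants $C^0_{insp},C^0_{rep},C^0_{out}$ are rational, with q given directly in (0,1) rather than through the rates $r_i$ and $r_d$. -}

module Defs where

open import Data.Nat as ℕ using (ℕ; zero; suc)
import Data.Nat.Properties as ℕP
open import Data.Fin using (Fin; toℕ; inject₁)
open import Data.List using (List; []; _∷_; length; filter; concatMap; map; upTo)
open import Data.List.Relation.Unary.Any using (any?)
open import Data.Product using (Σ; _,_; _×_; ∃)
open import Data.Sum using (_⊎_)
open import Data.Rational using (ℚ; 0ℚ; 1ℚ; _+_; _*_)
open import Relation.Binary.PropositionalEquality using (_≡_)
open import Relation.Nullary using (does)
open import Data.Bool using (if_then_else_)
open import Data.List using (allFin)

_^_ : ℚ → ℕ → ℚ
q ^ zero  = 1ℚ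
q ^ suc s = q * (q ^ s)

sumℚ : List ℚ → ℚ
sumℚ []       = 0ℚ
sumℚ (x ∷ xs) = x + sumℚ xs

-- Defects: group i (deadline T_{i+1}) has n i defects; a defect is (i , j), j < n i.
Defect : {N : ℕ} → (Fin N → ℕ) → Set
Defect {N} n = Σ (Fin N) (λ i → Fin (n i))

defects : {N : ℕ} (n : Fin N → ℕ) → List (Defect n)
defects {N} n = concatMap (λ i → map (λ j → (i , j)) (allFin (n i))) (allFin N)

Schedule : {N : ℕ} → (Fin N → ℕ) → Set
Schedule n = Defect n → ℕ

-- Total cost C(t, σ) with C_insp(s) = Ci q^s, C_rep(s) = Cr q^s, C_out(s) = Co q^s:
--   Ci q^t + Σ_{d, σ d ≤ t} Cr q^{σ d} + Σ_{r ∈ R_t(σ)} Co q^r,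
-- where R_t(σ) = {σ d} ∩ (0,t] (distinct times, enumerated as r = 1..t).
cost : (q Ci Cr Co : ℚ) {N : ℕ} (n : Fin N → ℕ) (t : ℕ) (σ : Schedule n) → ℚ
cost q Ci Cr Co n t σ =
  Ci * (q ^ t)
  + sumℚ (map (λ d → Cr * (q ^ σ d)) (filter (λ d → σ d ℕ.≤? t) (defects n)))
  + sumℚ (map (λ r → if does (any? (λ d → σ d ℕ.≟ r) (defects n)) then Co * (q ^ r) else 0ℚ)
              (map suc (upTo t)))

blockSchedule : {N : ℕ} (n : Fin N → ℕ) → (Fin N → ℕ) → Schedule n
blockSchedule n ρ (i , j) = ρ i

Nt : {N : ℕ} (T : Fin N → ℕ) (t : ℕ) → ℕ
Nt {N} T t = length (filter (λ i → T i ℕ.≤? t) (allFin N))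

-- 𝒜_t (on block repair times; index k : Fin N stands for group k+1):
--  if k+1 ≤ N_t : ρ k ∈ {T_0 = 0, T_1, …, T_{k+1}};  otherwise ρ k = T_{k+1}
InA : {N : ℕ} (T : Fin N → ℕ) (t : ℕ) (ρ : Fin N → ℕ) → Set
InA T t ρ = ∀ k → (suc (toℕ k) ℕ.≤ Nt T t → ρ k ≡ 0 ⊎ ∃ (λ j → toℕ j ℕ.≤ toℕ k × ρ k ≡ T j))
                × (Nt T t ℕ.< suc (toℕ k) → ρ k ≡ T k)

InB : {N : ℕ} (T : Fin N → ℕ) (t : ℕ) (ρ : Fin N → ℕ) → Set
InB {zero}  T t ρ = Data.Unit.⊤ where import Data.Unit
InB {suc N} T t ρ = first × rest
  where
  first : Set
  first = (1 ℕ.≤ Nt T t → ρ Fin.zero ≡ 0 ⊎ ρ Fin.zero ≡ T Fin.zero)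
        × (Nt T t ℕ.< 1 → ρ Fin.zero ≡ T Fin.zero)
    where import Data.Fin as Fin
  rest : Set
  rest = ∀ (k : Fin N) →
           (suc (suc (toℕ k)) ℕ.≤ Nt T t → ρ (Fin.suc k) ≡ T (Fin.suc k) ⊎ ρ (Fin.suc k) ≡ ρ (inject₁ k))
         × (Nt T t ℕ.< suc (suc (toℕ k)) → ρ (Fin.suc k) ≡ T (Fin.suc k))
    where import Data.Fin as Fin

{-# OPTIONS --safe #-}
-- Take any schedule ρ of 𝒜_t and postpone every group k ≤ N_t to the latest deadline
-- T_j (j ≤ k) at which ρ already repairs something, or leave it at 0 if there is none.
-- Since q ≤ 1 no repair becomes more expensive, and no new repair time appears, so the
-- out-of-service cost does not grow either. The postponed schedule lies in ℬ_t, and ℬ_t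
-- is the image of the 2^N bit vectors (bit k: repair group k at T_k, or together with
-- group k − 1), so the cheapest bit vector beats every schedule of 𝒜_t.
module Submission where

open import Defs
open import Data.Nat using (ℕ; _≤_; _<_)
open import Data.Fin using (Fin) renaming (_<_ to _<ᶠ_)
open import Data.Rational using (ℚ; 0ℚ; 1ℚ) renaming (_<_ to _<ℚ_; _≤_ to _≤ℚ_)
open import Data.Product using (Σ; _×_)

import Data.Nat.Properties as ℕP
import Data.Fin as F
import Data.Fin.Properties as FP
import Data.Rational as Q
import Data.Rational.Properties as QP
import Data.Sum as Sum
import Data.List.Relation.Unary.All as All
import Data.List.Relation.Unary.All.Properties as All
open import Data.Nat using (zero; suc; z≤n; s≤s; _≤?_; _≟_)
open import Data.Fin using (toℕ; inject₁)
open import Data.Vec using (Vec; []; _∷_; lookup; tabulate)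
open import Data.Vec.Properties using (lookup∘tabulate)
open import Data.Bool using (Bool; true; false; if_then_else_)
open import Data.List using ([]; _∷_; [_]; map; filter; upTo)
open import Data.List.Relation.Unary.All using (All)
open import Data.List.Relation.Unary.Any using (Any; any?; satisfied)
open import Data.List.Relation.Unary.Any.Properties using (concatMap⁺)
open import Data.List.Membership.Propositional using (_∈_; lose)
open import Data.List.Membership.Propositional.Properties using (∈-allFin; ∈-map⁺)
open import Relation.Binary.Bundles using (DecTotalOrder)
open import Data.List.Extrema (DecTotalOrder.totalOrder QP.≤-decTotalOrder)
  using (argmin; f[argmin]≤f[⊤]; f[argmin]≤f[xs])
open import Data.Product using (_,_; proj₁; proj₂; ∃)
open import Data.Sum using (_⊎_; inj₁; inj₂)
open import Data.Unit using (tt)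
open import Relation.Nullary using (Dec; yes; no; does; contradiction)
open import Relation.Nullary.Decidable using (dec-true; dec-false)
open import Relation.Unary using (Pred; Decidable; _⊆_)
open import Relation.Binary using (_Preserves_⟶_)
open import Relation.Binary.PropositionalEquality using (_≡_; refl; sym; trans; subst; cong)
open import Function using (_∘_)

if-cases : ∀ {a} {A : Set a} b {x y : A} → (if b then x else y) ≡ x ⊎ (if b then x else y) ≡ y
if-cases true  = inj₁ refl
if-cases false = inj₂ refl

if-does-mono : ∀ {A B : Set} (a? : Dec A) (b? : Dec B) {x : ℚ} → (A → B) → 0ℚ ≤ℚ x →
               (if does a? then x else 0ℚ) ≤ℚ (if does b? then x else 0ℚ)
if-does-mono (yes a) (yes _) _   _   = QP.≤-refl
if-does-mono (yes a) (no ¬b) a⇒b _   = contradiction (a⇒b a) ¬b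
if-does-mono (no _)  (yes _) _   0≤x = 0≤x
if-does-mono (no _)  (no _)  _   _   = QP.≤-refl

strictMono⇒mono : ∀ {N} {f : Fin N → ℕ} → (∀ i j → i <ᶠ j → f i < f j) → f Preserves F._≤_ ⟶ _≤_
strictMono⇒mono {f = f} f-strict {i} {j} i≤j with ℕP.m≤n⇒m<n∨m≡n i≤j
... | inj₁ i<j = ℕP.<⇒≤ (f-strict i j i<j)
... | inj₂ i≡j = ℕP.≤-reflexive (cong f (FP.toℕ-injective i≡j))

*-nonNeg : ∀ {p r} → 0ℚ ≤ℚ p → 0ℚ ≤ℚ r → 0ℚ ≤ℚ p Q.* r
*-nonNeg {p} {r} 0≤p 0≤r =
  QP.nonNegative⁻¹ _ {{QP.nonNeg*nonNeg⇒nonNeg p {{Q.nonNegative 0≤p}} r {{Q.nonNegative 0≤r}}}}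

*-monoˡ-≤-0≤ : ∀ {r p s} → 0ℚ ≤ℚ r → p ≤ℚ s → r Q.* p ≤ℚ r Q.* s
*-monoˡ-≤-0≤ {r} 0≤r = QP.*-monoˡ-≤-nonNeg r {{Q.nonNegative 0≤r}}

module _ {q : ℚ} (0≤q : 0ℚ ≤ℚ q) where

  ^-nonNeg : ∀ s → 0ℚ ≤ℚ q ^ s
  ^-nonNeg zero    = QP.nonNegative⁻¹ 1ℚ
  ^-nonNeg (suc s) = *-nonNeg 0≤q (^-nonNeg s)

  module _ (q≤1 : q ≤ℚ 1ℚ) where

    ^-≤-1 : ∀ s → q ^ s ≤ℚ 1ℚ
    ^-≤-1 zero    = QP.≤-refl
    ^-≤-1 (suc s) =
      QP.≤-trans (*-monoˡ-≤-0≤ 0≤q (^-≤-1 s)) (QP.≤-trans (QP.≤-reflexive (QP.*-identityʳ q)) q≤1)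

    ^-antitone : ∀ {a b} → a ≤ b → q ^ b ≤ℚ q ^ a
    ^-antitone {b = b} z≤n = ^-≤-1 b
    ^-antitone (s≤s a≤b)   = *-monoˡ-≤-0≤ 0≤q (^-antitone a≤b)

sumℚ-mono : ∀ {A : Set} {f g : A → ℚ} {xs} → All (λ x → f x ≤ℚ g x) xs →
            sumℚ (map f xs) ≤ℚ sumℚ (map g xs)
sumℚ-mono All.[]         = QP.≤-refl
sumℚ-mono (fx≤gx All.∷ h) = QP.+-mono-≤ fx≤gx (sumℚ-mono h)

sumℚ-filter-mono : ∀ {A : Set} {p q} {P : Pred A p} {Q : Pred A q} (P? : Decidable P) (Q? : Decidable Q)
                   {f g : A → ℚ} →
                   P ⊆ Q → (∀ {x} → P x → f x ≤ℚ g x) → (∀ {x} → Q x → 0ℚ ≤ℚ g x) →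
                   ∀ xs → sumℚ (map f (filter P? xs)) ≤ℚ sumℚ (map g (filter Q? xs))
sumℚ-filter-mono P? Q? P⊆Q f≤g 0≤g [] = QP.≤-refl
sumℚ-filter-mono P? Q? P⊆Q f≤g 0≤g (x ∷ xs) with P? x | Q? x
... | yes px | yes _  = QP.+-mono-≤ (f≤g px) (sumℚ-filter-mono P? Q? P⊆Q f≤g 0≤g xs)
... | yes px | no ¬qx = contradiction (P⊆Q px) ¬qx
... | no _   | yes qx = QP.≤-trans (QP.≤-reflexive (sym (QP.+-identityˡ _)))
                          (QP.+-mono-≤ (0≤g qx) (sumℚ-filter-mono P? Q? P⊆Q f≤g 0≤g xs))
... | no _   | no _   = sumℚ-filter-mono P? Q? P⊆Q f≤g 0≤g xs

∈-defects : ∀ {N} {n : Fin N → ℕ} (d : Defect n) → d ∈ defects n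
∈-defects (i , j) = concatMap⁺ _ (lose (∈-allFin i) (∈-map⁺ (i ,_) (∈-allFin j)))

module _ {q Cr Co : ℚ} (0≤q : 0ℚ ≤ℚ q) (q≤1 : q ≤ℚ 1ℚ) (0≤Cr : 0ℚ ≤ℚ Cr) (0≤Co : 0ℚ ≤ℚ Co)
         {N} {n : Fin N → ℕ} (t : ℕ) where

  cost-mono : ∀ {σ σ′ : Schedule n} → (∀ d → σ′ d ≤ σ d) →
              (∀ {d r} → σ d ≡ suc r → Any (λ d′ → σ′ d′ ≡ suc r) (defects n)) →
              ∀ Ci → cost q Ci Cr Co n t σ ≤ℚ cost q Ci Cr Co n t σ′
  cost-mono {σ} {σ′} σ′≤σ σ-times⊆σ′-times Ci =
    QP.+-mono-≤ (QP.+-mono-≤ (QP.≤-refl {Ci Q.* (q ^ t)}) repairs) outages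
    where
    repairs : sumℚ (map (λ d → Cr Q.* (q ^ σ d)) (filter (λ d → σ d ≤? t) (defects n)))
           ≤ℚ sumℚ (map (λ d → Cr Q.* (q ^ σ′ d)) (filter (λ d → σ′ d ≤? t) (defects n)))
    repairs = sumℚ-filter-mono (λ d → σ d ≤? t) (λ d → σ′ d ≤? t)
      (λ {d} → ℕP.≤-trans (σ′≤σ d))
      (λ {d} _ → *-monoˡ-≤-0≤ 0≤Cr (^-antitone 0≤q q≤1 (σ′≤σ d)))
      (λ {d} _ → *-nonNeg 0≤Cr (^-nonNeg 0≤q (σ′ d)))
      (defects n)

    outage : Schedule n → ℕ → ℚ
    outage σ r = if does (any? (λ d → σ d ≟ r) (defects n)) then Co Q.* (q ^ r) else 0ℚ

    outages : sumℚ (map (outage σ) (map suc (upTo t)))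
           ≤ℚ sumℚ (map (outage σ′) (map suc (upTo t)))
    outages = sumℚ-mono (All.map⁺ (All.universal outage-mono (upTo t)))
      where
      outage-mono : ∀ r → outage σ (suc r) ≤ℚ outage σ′ (suc r)
      outage-mono r =
        if-does-mono (any? (λ d → σ d ≟ suc r) (defects n)) (any? (λ d → σ′ d ≟ suc r) (defects n))
        (λ used → σ-times⊆σ′-times (proj₂ (satisfied used)))
        (*-nonNeg 0≤Co (^-nonNeg 0≤q (suc r)))

  blockSchedule-cost-mono : (∀ i → 1 ≤ n i) → ∀ {ρ ρ′ : Fin N → ℕ} → (∀ k → ρ′ k ≤ ρ k) →
                            (∀ {k r} → ρ k ≡ suc r → ∃ λ k′ → ρ′ k′ ≡ suc r) →
                            ∀ Ci → cost q Ci Cr Co n t (blockSchedule n ρ)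
                                 ≤ℚ cost q Ci Cr Co n t (blockSchedule n ρ′)
  blockSchedule-cost-mono n≥1 {ρ} {ρ′} ρ′≤ρ ρ-times⊆ρ′-times =
    cost-mono {blockSchedule n ρ} {blockSchedule n ρ′} (λ (k , _) → ρ′≤ρ k) λ {(k , _)} ρk≡r →
      let k′ , ρ′k′≡r = ρ-times⊆ρ′-times ρk≡r in lose (∈-defects (k′ , F.fromℕ< (n≥1 k′))) ρ′k′≡r

bitVector-argmin : ∀ N (f : Vec Bool N → ℚ) → Σ (Vec Bool N) λ v → ∀ w → f v ≤ℚ f w
bitVector-argmin zero    f = [] , λ { [] → QP.≤-refl }
bitVector-argmin (suc N) f = best , best≤
  where
  bestWith : ∀ b → Σ (Vec Bool N) λ v → ∀ w → f (b ∷ v) ≤ℚ f (b ∷ w)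
  bestWith b = bitVector-argmin N (f ∘ (b ∷_))

  best : Vec Bool (suc N)
  best = argmin f (true ∷ proj₁ (bestWith true)) [ false ∷ proj₁ (bestWith false) ]

  best≤ : ∀ w → f best ≤ℚ f w
  best≤ (true  ∷ w) = QP.≤-trans (f[argmin]≤f[⊤] {f = f} _ [ _ ]) (proj₂ (bestWith true) w)
  best≤ (false ∷ w) = QP.≤-trans (All.head (f[argmin]≤f[xs] {f = f} _ [ _ ])) (proj₂ (bestWith false) w)

-- ρ_k = T_k if bit k is set and ρ_{k−1} otherwise, with ρ_{−1} = ρ₋.
cascade : ∀ {N} → (Fin N → ℕ) → ℕ → Vec Bool N → Fin N → ℕ
cascade T ρ₋ (b ∷ bs) F.zero    = if b then T F.zero else ρ₋
cascade T ρ₋ (b ∷ bs) (F.suc k) = cascade (T ∘ F.suc) (if b then T F.zero else ρ₋) bs k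

cascade-suc : ∀ {N} (T : Fin (suc N) → ℕ) ρ₋ bs k →
              cascade T ρ₋ bs (F.suc k)
                ≡ (if lookup bs (F.suc k) then T (F.suc k) else cascade T ρ₋ bs (inject₁ k))
cascade-suc T ρ₋ (b ∷ b′ ∷ bs) F.zero    = refl
cascade-suc T ρ₋ (b ∷ bs)      (F.suc k) = cascade-suc (T ∘ F.suc) _ bs k

cascade-source : ∀ {N} (T : Fin N → ℕ) ρ₋ bs k →
                 cascade T ρ₋ bs k ≡ ρ₋ ⊎ ∃ λ j → lookup bs j ≡ true × cascade T ρ₋ bs k ≡ T j
cascade-source T ρ₋ (true  ∷ bs) F.zero    = inj₂ (F.zero , refl , refl)
cascade-source T ρ₋ (false ∷ bs) F.zero    = inj₁ refl
cascade-source T ρ₋ (b ∷ bs)     (F.suc k)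
  with cascade-source (T ∘ F.suc) (if b then T F.zero else ρ₋) bs k
... | inj₂ (j , bit , eq) = inj₂ (F.suc j , bit , eq)
... | inj₁ eq with b
...   | true  = inj₂ (F.zero , refl , eq)
...   | false = inj₁ eq

cascade-≥ : ∀ {N} {T : Fin N → ℕ} → T Preserves F._≤_ ⟶ _≤_ → ∀ ρ₋ bs {j k} →
            lookup bs j ≡ true → j F.≤ k → T j ≤ cascade T ρ₋ bs k
cascade-≥ T-mono ρ₋ (true ∷ bs) {F.zero} {F.zero} _ _ = ℕP.≤-refl
cascade-≥ {T = T} T-mono ρ₋ (true ∷ bs) {F.zero} {F.suc k} _ _
  with cascade-source (T ∘ F.suc) (T F.zero) bs k
... | inj₁ eq           = ℕP.≤-reflexive (sym eq)
... | inj₂ (j , _ , eq) = subst (T F.zero ≤_) (sym eq) (T-mono {F.zero} {F.suc j} z≤n)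
cascade-≥ T-mono ρ₋ (b ∷ bs) {F.suc j} {F.suc k} bit (s≤s j≤k) =
  cascade-≥ (λ i≤i′ → T-mono (s≤s i≤i′)) _ bs bit j≤k

ℬ-times : ∀ {N} → (Fin N → ℕ) → ℕ → Vec Bool N → Fin N → ℕ
ℬ-times T t bs k = if does (suc (toℕ k) ≤? Nt T t) then cascade T 0 bs k else T k

module _ {N} (T : Fin N → ℕ) (t : ℕ) (bs : Vec Bool N) where

  ℬ-times-<Nt : ∀ {k} → suc (toℕ k) ≤ Nt T t → ℬ-times T t bs k ≡ cascade T 0 bs k
  ℬ-times-<Nt {k} k<Nt rewrite dec-true (suc (toℕ k) ≤? Nt T t) k<Nt = refl

  ℬ-times-≥Nt : ∀ {k} → Nt T t < suc (toℕ k) → ℬ-times T t bs k ≡ T k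
  ℬ-times-≥Nt {k} Nt≤k rewrite dec-false (suc (toℕ k) ≤? Nt T t) (ℕP.<⇒≱ Nt≤k) = refl

  ℬ-times-cases : ∀ k → suc (toℕ k) ≤ Nt T t × ℬ-times T t bs k ≡ cascade T 0 bs k
                      ⊎ Nt T t < suc (toℕ k) × ℬ-times T t bs k ≡ T k
  ℬ-times-cases k with suc (toℕ k) ≤? Nt T t
  ... | yes k<Nt = inj₁ (k<Nt , ℬ-times-<Nt k<Nt)
  ... | no k≮Nt  = inj₂ (ℕP.≰⇒> k≮Nt , ℬ-times-≥Nt (ℕP.≰⇒> k≮Nt))

ℬ-times-∈B : ∀ {N} (T : Fin N → ℕ) t bs → InB T t (ℬ-times T t bs)
ℬ-times-∈B {zero}  T t bs       = tt
ℬ-times-∈B {suc N} T t (b ∷ bs) = (first , ℬ-times-≥Nt T t (b ∷ bs)) , λ k → next k , ℬ-times-≥Nt T t (b ∷ bs)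
  where
  ρ : Fin (suc N) → ℕ
  ρ = ℬ-times T t (b ∷ bs)

  first : 1 ≤ Nt T t → ρ F.zero ≡ 0 ⊎ ρ F.zero ≡ T F.zero
  first 0<Nt = Sum.swap (Sum.map (trans ρ₀≡) (trans ρ₀≡) (if-cases b))
    where
    ρ₀≡ : ρ F.zero ≡ (if b then T F.zero else 0)
    ρ₀≡ = ℬ-times-<Nt T t (b ∷ bs) 0<Nt

  next : ∀ k → suc (suc (toℕ k)) ≤ Nt T t → ρ (F.suc k) ≡ T (F.suc k) ⊎ ρ (F.suc k) ≡ ρ (inject₁ k)
  next k k+1<Nt = Sum.map (trans ρₖ₊₁≡) (λ eq → trans (trans ρₖ₊₁≡ eq) (sym (ℬ-times-<Nt T t (b ∷ bs) k<Nt)))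
                          (if-cases (lookup (b ∷ bs) (F.suc k)))
    where
    ρₖ₊₁≡ : ρ (F.suc k) ≡ (if lookup (b ∷ bs) (F.suc k) then T (F.suc k) else cascade T 0 (b ∷ bs) (inject₁ k))
    ρₖ₊₁≡ = trans (ℬ-times-<Nt T t (b ∷ bs) k+1<Nt) (cascade-suc T 0 (b ∷ bs) k)

    k<Nt : suc (toℕ (inject₁ k)) ≤ Nt T t
    k<Nt = subst (λ i → suc i ≤ Nt T t) (sym (FP.toℕ-inject₁ k)) (ℕP.<⇒≤ k+1<Nt)

usedDeadlines : ∀ {N} → (Fin N → ℕ) → (Fin N → ℕ) → Vec Bool N
usedDeadlines T ρ = tabulate λ j → does (FP.any? λ i → ρ i ≟ T j)

module _ {N} (T : Fin N → ℕ) (ρ : Fin N → ℕ) where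

  usedDeadlines-complete : ∀ {j k} → ρ k ≡ T j → lookup (usedDeadlines T ρ) j ≡ true
  usedDeadlines-complete {j} {k} ρk≡Tj =
    trans (lookup∘tabulate _ j) (dec-true (FP.any? λ i → ρ i ≟ T j) (k , ρk≡Tj))

  usedDeadlines-sound : ∀ {j} → lookup (usedDeadlines T ρ) j ≡ true → ∃ λ k → ρ k ≡ T j
  usedDeadlines-sound {j} bit with FP.any? (λ i → ρ i ≟ T j) | trans (sym (lookup∘tabulate _ j)) bit
  ... | yes used | _  = used
  ... | no _     | ()

postponed : ∀ {N} → (Fin N → ℕ) → ℕ → (Fin N → ℕ) → Fin N → ℕ
postponed T t ρ = ℬ-times T t (usedDeadlines T ρ)

module _ {N} {T : Fin N → ℕ} (T-mono : T Preserves F._≤_ ⟶ _≤_) {t} {ρ : Fin N → ℕ} (ρ∈A : InA T t ρ) where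

  private
    bits : Vec Bool N
    bits = usedDeadlines T ρ

  ≤-postponed : ∀ k → ρ k ≤ postponed T t ρ k
  ≤-postponed k with ℬ-times-cases T t bits k
  ... | inj₂ (Nt≤k , eq) = ℕP.≤-reflexive (trans (proj₂ (ρ∈A k) Nt≤k) (sym eq))
  ... | inj₁ (k<Nt , eq) = ℕP.≤-trans (≤-cascade (proj₁ (ρ∈A k) k<Nt)) (ℕP.≤-reflexive (sym eq))
    where
    ≤-cascade : ρ k ≡ 0 ⊎ ∃ (λ j → j F.≤ k × ρ k ≡ T j) → ρ k ≤ cascade T 0 bits k
    ≤-cascade (inj₁ ρk≡0)             = ℕP.≤-trans (ℕP.≤-reflexive ρk≡0) z≤n
    ≤-cascade (inj₂ (j , j≤k , ρk≡Tj)) =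
      ℕP.≤-trans (ℕP.≤-reflexive ρk≡Tj) (cascade-≥ T-mono 0 bits (usedDeadlines-complete T ρ ρk≡Tj) j≤k)

  postponed-times⊆ : ∀ {k r} → postponed T t ρ k ≡ suc r → ∃ λ k′ → ρ k′ ≡ suc r
  postponed-times⊆ {k} ρ̂k≡r with ℬ-times-cases T t bits k
  ... | inj₂ (Nt≤k , eq) = k , trans (proj₂ (ρ∈A k) Nt≤k) (trans (sym eq) ρ̂k≡r)
  ... | inj₁ (_ , eq) with cascade-source T 0 bits k
  ...   | inj₁ c≡0             = contradiction (trans (sym c≡0) (trans (sym eq) ρ̂k≡r)) ℕP.0≢1+n
  ...   | inj₂ (j , bit , c≡Tj) =
    let k′ , ρk′≡Tj = usedDeadlines-sound T ρ bit in k′ , trans ρk′≡Tj (trans (sym c≡Tj) (trans (sym eq) ρ̂k≡r))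

proposition3 : (Tstar N : ℕ) → 1 ≤ Tstar → 1 ≤ N →
    (T : Fin N → ℕ) → (∀ i j → i <ᶠ j → T i < T j) → (∀ i → 0 < T i) → (∀ i → T i < Tstar) →
    (n : Fin N → ℕ) → (∀ i → 1 ≤ n i) →
    (q Ci Cr Co : ℚ) → 0ℚ <ℚ q → q <ℚ 1ℚ → 0ℚ <ℚ Ci → 0ℚ <ℚ Cr → 0ℚ <ℚ Co →
    (t : ℕ) → 1 ≤ t → t ≤ Tstar →
    Σ (Fin N → ℕ) (λ ρ → InB T t ρ ×
      (∀ ρ′ → InA T t ρ′ →
        cost q Ci Cr Co n t (blockSchedule n ρ) ≤ℚ cost q Ci Cr Co n t (blockSchedule n ρ′)))
proposition3 _ N _ _ T T-strict _ _ n n≥1 q Ci Cr Co 0<q q<1 _ 0<Cr 0<Co t _ _ =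
  ℬ-times T t best , ℬ-times-∈B T t best , optimal
  where
  C : (Fin N → ℕ) → ℚ
  C ρ = cost q Ci Cr Co n t (blockSchedule n ρ)

  best : Vec Bool N
  best = proj₁ (bitVector-argmin N (C ∘ ℬ-times T t))

  optimal : ∀ ρ′ → InA T t ρ′ → C (ℬ-times T t best) ≤ℚ C ρ′
  optimal ρ′ ρ′∈A = QP.≤-trans (proj₂ (bitVector-argmin N (C ∘ ℬ-times T t)) (usedDeadlines T ρ′))
    (blockSchedule-cost-mono (QP.<⇒≤ 0<q) (QP.<⇒≤ q<1) (QP.<⇒≤ 0<Cr) (QP.<⇒≤ 0<Co) t n≥1
      (≤-postponed T-mono ρ′∈A) (postponed-times⊆ T-mono ρ′∈A) Ci)
    where
    T-mono : T Preserves F._≤_ ⟶ _≤_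
    T-mono = strictMono⇒mono T-strict
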